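{- Let $u,v,w$ be three pairwise distinct vertices and let $T(u,v,w)$ be the graph consisting of $u,v,w$, an $F'$-gadget between $u$ and $v$, an $F'$-gadget between $u$ and $w$, and an $F'$-gadget between $v$ and $w$ (the three gadgets having pairwise disjoint sets of internal vertices). Then: (1) $\mathrm{mcut}(T(u,v,w)) = 3\cdot \mathrm{mcut}(F') - C$; (2) every partition $(V_1,V_2)$ of $T(u,v,w)$ with $u,v,w\in V_1$ satisfies $|E_{T(u,v,w)}(V_1,V_2)|\le \mathrm{mcut}(T(u,v,w)) - 2C$; (3) every partition of $\{u,v,w\}$ that does not place all three vertices on the same side can be extended to an optimal partition of $T(u,v,w)$.
   Context: Fix integers $n\ge1$, $D\ge1$ and set $C = D^2\binom{2n}{2}+1$. For distinct vertices $a,b$, an $F'$-gadget between $a$ and $b$, $F'(a,b)$, is the graph consisting of $C$ paths of length 3 (3 edges) between $a$ and $b$ that are pairwise disjoint apart from $a,b$. For a graph $Q$, a partition of $Q$ is a pair $(V_1,V_2)$ partitioning $V(Q)$ (sides may be empty), $E_Q(V_1,V_2)$ is the set of edges with one endpoint in each side, $\mathrm{mcut}(Q)$ is the maximum of $|E_Q(V_1,V_2)|$ over all partitions, and a partition is optimal if it attains this maximum. $\mathrm{mcut}(F')$ denotes $\mathrm{mcut}(F'(a,b))$, which does not depend on $a,b$. -}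

module Defs where

open import Data.Nat using (ℕ; zero; suc; _+_; _*_; _^_; _⊔_)
open import Data.Nat.Combinatorics using (_C_)
open import Data.Fin using (Fin; zero; suc; combine; _↑ʳ_)
open import Data.Bool using (Bool; true; false; _xor_)
open import Data.List using (List; []; _∷_; map; concatMap; foldr; length; filter; allFin)
open import Data.Product using (_×_; _,_)
open import Data.Vec.Functional using (Vector) renaming (_∷_ to _∷ᵥ_)
open import Data.Bool.Properties using (T?)
open import Data.Bool using (T)

record Graph : Set where
  constructor graph
  field
    N     : ℕ
    edges : List (Fin N × Fin N)
open Graph public

-- A partition (V₁,V₂) of V(Q) is a map p : V(Q) → Bool with V₁ = p⁻¹(true), V₂ = p⁻¹(false).
Partition : Graph → Set
Partition Q = Fin (N Q) → Bool

crossing : ∀ {n} → (Fin n → Bool) → Fin n × Fin n → Bool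
crossing p (x , y) = p x xor p y

cutSize : (Q : Graph) → Partition Q → ℕ
cutSize Q p = length (filter (λ e → T? (crossing p e)) (edges Q))

allPartitions : (n : ℕ) → List (Fin n → Bool)
allPartitions zero = (λ ()) ∷ []
allPartitions (suc n) = concatMap (λ f → (false ∷ᵥ f) ∷ (true ∷ᵥ f) ∷ []) (allPartitions n)

mcut : Graph → ℕ
mcut Q = foldr _⊔_ 0 (map (cutSize Q) (allPartitions (N Q)))

Cconst : ℕ → ℕ → ℕ
Cconst n D = D ^ 2 * ((2 * n) C 2) + 1

-- edges of an F'-gadget with c paths between a and b; path i has internal
-- vertices int i 0 and int i 1, edges a–int i 0, int i 0–int i 1, int i 1–b.
gadgetEdges : ∀ {m} (c : ℕ) → Fin m → Fin m → (Fin c → Fin 2 → Fin m) → List (Fin m × Fin m)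
gadgetEdges c a b int =
  concatMap (λ i → (a , int i zero) ∷ (int i zero , int i (suc zero)) ∷ (int i (suc zero) , b) ∷ [])
            (allFin c)

-- F'(a,b): vertices a = 0, b = 1, internal vertices 2 + (2i + j)
F' : ℕ → Graph
F' c = graph (2 + c * 2)
  (gadgetEdges c zero (suc zero) (λ i j → suc (suc (combine i j))))

-- T(u,v,w): u = 0, v = 1, w = 2; gadget g ∈ {0,1,2} has internal vertices 3 + combine g (combine i j);
-- gadget 0 joins u,v; gadget 1 joins u,w; gadget 2 joins v,w.
TN : ℕ → ℕ
TN c = 3 + 3 * (c * 2)

tu tv tw : (c : ℕ) → Fin (TN c)
tu c = zero
tv c = suc zero
tw c = suc (suc zero)

tint : ∀ {c} → Fin 3 → Fin c → Fin 2 → Fin (TN c)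
tint {c} g i j = 3 ↑ʳ combine g (combine i j)

Tgraph : ℕ → Graph
Tgraph c = graph (TN c)
  (gadgetEdges c (tu c) (tv c) (tint zero)
   Data.List.++ gadgetEdges c (tu c) (tw c) (tint (suc zero))
   Data.List.++ gadgetEdges c (tv c) (tw c) (tint (suc (suc zero))))

-- A path a–x–y–b of length 3 cuts at most two of its edges if a and b lie on the same side and
-- at most three otherwise, with equality when x is put opposite to a and y next to a. So an
-- F'-gadget with c paths cuts at most c(2 + [a,b separated]) edges, attained by that alternating
-- labelling, and mcut(F') = 3c. In T the three gadgets cut at most c(6 + t), where t ≤ 2 counts
-- the separated pairs among u, v, w; t = 2 unless u, v, w lie on one side, when t = 0. Hence
-- mcut(T) = 8c = 3·mcut(F') − c, monochromatic partitions lose 2c, and any non-monochromatic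
-- labelling of u, v, w extends alternatingly to an optimal partition.
module Submission where

open import Defs
open import Data.Nat using (ℕ; _+_; _*_; _≤_; _≥_)
open import Data.Bool using (Bool; true; false)
open import Data.Product using (_×_; Σ)
open import Relation.Binary.PropositionalEquality using (_≡_)
open import Relation.Nullary using (¬_)

open import Data.Nat using (zero; suc; _⊔_; _≤ᵇ_; z≤n)
open import Data.Nat.Properties
open import Data.Nat.Tactic.RingSolver using (solve-∀)
open import Data.Bool using (_xor_; not; T; if_then_else_)
open import Data.Bool.Properties using (T?)
open import Data.Unit using (tt)
open import Data.Empty using (⊥-elim)
open import Data.Fin using (Fin; remQuot; combine) renaming (zero to fzero; suc to fsuc)
open import Data.Fin.Properties using (remQuot-combine)
open import Data.List using (List; []; _∷_; _++_; concatMap; foldr; length; filter; allFin)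
open import Data.List.Properties using (length-++; filter-++; length-tabulate)
open import Data.List.Relation.Unary.Any as Any using (Any; here; there)
open import Data.List.Relation.Unary.Any.Properties using (concatMap⁺) renaming (map⁺ to Any-map⁺)
open import Data.List.Relation.Unary.All using (All; []; _∷_; universal)
open import Data.List.Relation.Unary.All.Properties using () renaming (map⁺ to All-map⁺)
open import Data.Product using (_,_; proj₂)
open import Data.Vec.Functional using () renaming (_∷_ to _∷ᵥ_)
open import Function using (_∘_)
open import Relation.Binary.PropositionalEquality using (refl; sym; trans; cong; cong₂; _≗_; module ≡-Reasoning)

indicator : Bool → ℕ
indicator b = if b then 1 else 0

indicator≤1 : ∀ b → indicator b ≤ 1
indicator≤1 false = z≤n
indicator≤1 true  = ≤-refl

differ : Bool → Bool → ℕ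
differ a b = indicator (a xor b)

crossingCount : ∀ {m} → (Fin m → Bool) → List (Fin m × Fin m) → ℕ
crossingCount p es = length (filter (λ e → T? (crossing p e)) es)

module _ {m} (p : Fin m → Bool) where

  crossingCount-∷ : ∀ e es → crossingCount p (e ∷ es) ≡ indicator (crossing p e) + crossingCount p es
  crossingCount-∷ e es with crossing p e
  ... | true  = refl
  ... | false = refl

  crossingCount-++ : ∀ xs ys → crossingCount p (xs ++ ys) ≡ crossingCount p xs + crossingCount p ys
  crossingCount-++ xs ys = trans (cong length (filter-++ crosses? xs ys)) (length-++ (filter crosses? xs))
    where crosses? = λ e → T? (crossing p e)

  crossingCount-concatMap-≤ : ∀ {I : Set} (f : I → List (Fin m × Fin m)) {k} →
    (∀ i → crossingCount p (f i) ≤ k) → ∀ is → crossingCount p (concatMap f is) ≤ length is * k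
  crossingCount-concatMap-≤ f bound []       = z≤n
  crossingCount-concatMap-≤ f bound (i ∷ is) =
    ≤-trans (≤-reflexive (crossingCount-++ (f i) (concatMap f is)))
            (+-mono-≤ (bound i) (crossingCount-concatMap-≤ f bound is))

  crossingCount-concatMap-≡ : ∀ {I : Set} (f : I → List (Fin m × Fin m)) {k} →
    (∀ i → crossingCount p (f i) ≡ k) → ∀ is → crossingCount p (concatMap f is) ≡ length is * k
  crossingCount-concatMap-≡ f exact []       = refl
  crossingCount-concatMap-≡ f exact (i ∷ is) =
    trans (crossingCount-++ (f i) (concatMap f is))
          (cong₂ _+_ (exact i) (crossingCount-concatMap-≡ f exact is))

crossingCount-cong : ∀ {m} {p q : Fin m → Bool} → p ≗ q → ∀ es → crossingCount p es ≡ crossingCount q es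
crossingCount-cong p≗q []             = refl
crossingCount-cong {p = p} {q} p≗q ((x , y) ∷ es) = begin
  crossingCount p ((x , y) ∷ es)
    ≡⟨ crossingCount-∷ p (x , y) es ⟩
  indicator (p x xor p y) + crossingCount p es
    ≡⟨ cong₂ (λ a b → indicator (a xor b) + crossingCount p es) (p≗q x) (p≗q y) ⟩
  indicator (q x xor q y) + crossingCount p es
    ≡⟨ cong (indicator (q x xor q y) +_) (crossingCount-cong p≗q es) ⟩
  indicator (q x xor q y) + crossingCount q es
    ≡⟨ crossingCount-∷ q (x , y) es ⟨
  crossingCount q ((x , y) ∷ es) ∎
  where open ≡-Reasoning

path3 : ∀ {m} → Fin m → Fin m → Fin m → Fin m → List (Fin m × Fin m)
path3 a x y b = (a , x) ∷ (x , y) ∷ (y , b) ∷ []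

pathCut : Bool → Bool → Bool → Bool → ℕ
pathCut a x y b = differ a x + (differ x y + differ y b)

crossingCount-path3 : ∀ {m} (p : Fin m → Bool) a x y b →
  crossingCount p (path3 a x y b) ≡ pathCut (p a) (p x) (p y) (p b)
crossingCount-path3 p a x y b =
  trans (crossingCount-∷ p (a , x) _) (cong (differ (p a) (p x) +_)
  (trans (crossingCount-∷ p (x , y) _) (cong (differ (p x) (p y) +_)
  (trans (crossingCount-∷ p (y , b) []) (+-identityʳ _)))))

pathCut-≤ : ∀ a x y b → pathCut a x y b ≤ 2 + differ a b
pathCut-≤ a x y b = ≤ᵇ⇒≤ _ _ (check a x y b)
  where
  check : ∀ a x y b → T (pathCut a x y b ≤ᵇ 2 + differ a b)
  check false false false false = tt
  check false false false true  = tt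
  check false false true  false = tt
  check false false true  true  = tt
  check false true  false false = tt
  check false true  false true  = tt
  check false true  true  false = tt
  check false true  true  true  = tt
  check true  false false false = tt
  check true  false false true  = tt
  check true  false true  false = tt
  check true  false true  true  = tt
  check true  true  false false = tt
  check true  true  false true  = tt
  check true  true  true  false = tt
  check true  true  true  true  = tt

pathCut-alternating : ∀ a b → pathCut a (not a) a b ≡ 2 + differ a b
pathCut-alternating false false = refl
pathCut-alternating false true  = refl
pathCut-alternating true  false = refl
pathCut-alternating true  true  = refl

module _ {m} (c : ℕ) (a b : Fin m) (int : Fin c → Fin 2 → Fin m) (p : Fin m → Bool) where

  private
    path : Fin c → List (Fin m × Fin m)
    path i = path3 a (int i fzero) (int i (fsuc fzero)) b

    length-allFin : length (allFin c) ≡ c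
    length-allFin = length-tabulate (λ i → i)

  gadgetCut-≤ : crossingCount p (gadgetEdges c a b int) ≤ c * (2 + differ (p a) (p b))
  gadgetCut-≤ = ≤-trans
    (crossingCount-concatMap-≤ p path {2 + differ (p a) (p b)}
      (λ i → ≤-trans (≤-reflexive (crossingCount-path3 p _ _ _ _)) (pathCut-≤ (p a) _ _ (p b)))
      (allFin c))
    (≤-reflexive (cong (_* (2 + differ (p a) (p b))) length-allFin))

  gadgetCut-alternating : (∀ i → p (int i fzero) ≡ not (p a)) → (∀ i → p (int i (fsuc fzero)) ≡ p a) →
    crossingCount p (gadgetEdges c a b int) ≡ c * (2 + differ (p a) (p b))
  gadgetCut-alternating first second = trans
    (crossingCount-concatMap-≡ p path {2 + differ (p a) (p b)}
      (λ i → trans (crossingCount-path3 p _ _ _ _)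
        (trans (cong₂ (λ x y → pathCut (p a) x y (p b)) (first i) (second i))
               (pathCut-alternating (p a) (p b))))
      (allFin c))
    (cong (_* (2 + differ (p a) (p b))) length-allFin)

≤-foldr-⊔ : ∀ {m} {xs : List ℕ} → Any (m ≤_) xs → m ≤ foldr _⊔_ 0 xs
≤-foldr-⊔ {xs = x ∷ xs} (here m≤x)  = ≤-trans m≤x (m≤m⊔n x _)
≤-foldr-⊔ {xs = x ∷ xs} (there m≤xs) = ≤-trans (≤-foldr-⊔ m≤xs) (m≤n⊔m x _)

foldr-⊔-≤ : ∀ {b} {xs : List ℕ} → All (_≤ b) xs → foldr _⊔_ 0 xs ≤ b
foldr-⊔-≤ []             = z≤n
foldr-⊔-≤ (x≤b ∷ xs≤b) = ⊔-lub x≤b (foldr-⊔-≤ xs≤b)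

allPartitions-complete : ∀ n (p : Fin n → Bool) → Any (_≗ p) (allPartitions n)
allPartitions-complete zero    p = here (λ ())
allPartitions-complete (suc n) p =
  concatMap⁺ (λ q → (false ∷ᵥ q) ∷ (true ∷ᵥ q) ∷ [])
             (Any.map extend (allPartitions-complete n (p ∘ fsuc)))
  where
  extend : ∀ {q} → q ≗ p ∘ fsuc → Any (_≗ p) ((false ∷ᵥ q) ∷ (true ∷ᵥ q) ∷ [])
  extend q≗p with p fzero in p₀
  ... | false = here  λ { fzero → sym p₀ ; (fsuc i) → q≗p i }
  ... | true  = there (here λ { fzero → sym p₀ ; (fsuc i) → q≗p i })

cutSize≤mcut : ∀ Q (p : Partition Q) → cutSize Q p ≤ mcut Q
cutSize≤mcut Q p = ≤-foldr-⊔ (Any-map⁺ (Any.map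
  (λ q≗p → ≤-reflexive (crossingCount-cong (sym ∘ q≗p) (edges Q)))
  (allPartitions-complete (N Q) p)))

mcut-≤ : ∀ Q {b} → (∀ p → cutSize Q p ≤ b) → mcut Q ≤ b
mcut-≤ Q bound = foldr-⊔-≤ (All-map⁺ (universal bound (allPartitions (N Q))))

mcut-attained : ∀ Q {b} → (∀ p → cutSize Q p ≤ b) → (p₀ : Partition Q) → cutSize Q p₀ ≡ b → mcut Q ≡ b
mcut-attained Q bound p₀ refl = ≤-antisym (mcut-≤ Q bound) (cutSize≤mcut Q p₀)

alternate : Bool → Fin 2 → Bool
alternate s fzero        = not s
alternate s (fsuc fzero) = s

F'-partition : ∀ c → Partition (F' c)
F'-partition c fzero           = true
F'-partition c (fsuc fzero)    = false
F'-partition c (fsuc (fsuc k)) = alternate true (proj₂ (remQuot {c} 2 k))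

F'-partition-internal : ∀ c (i : Fin c) j → F'-partition c (fsuc (fsuc (combine i j))) ≡ alternate true j
F'-partition-internal c i j = cong (alternate true ∘ proj₂) (remQuot-combine i j)

mcut-F' : ∀ c → mcut (F' c) ≡ c * 3
mcut-F' c = mcut-attained (F' c)
  (λ p → ≤-trans (gadgetCut-≤ c _ _ internal p)
                 (*-monoʳ-≤ c (+-monoʳ-≤ 2 (indicator≤1 (p fzero xor p (fsuc fzero))))))
  (F'-partition c)
  (gadgetCut-alternating c _ _ internal (F'-partition c)
    (λ i → F'-partition-internal c i fzero) (λ i → F'-partition-internal c i (fsuc fzero)))
  where
  internal : Fin c → Fin 2 → Fin (2 + c * 2)
  internal i j = fsuc (fsuc (combine i j))

triangleCut : Bool → Bool → Bool → ℕ
triangleCut a b d = differ a b + differ a d + differ b d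

triangleCut-≤ : ∀ a b d → triangleCut a b d ≤ 2
triangleCut-≤ a b d = ≤ᵇ⇒≤ _ _ (check a b d)
  where
  check : ∀ a b d → T (triangleCut a b d ≤ᵇ 2)
  check false false false = tt
  check false false true  = tt
  check false true  false = tt
  check false true  true  = tt
  check true  false false = tt
  check true  false true  = tt
  check true  true  false = tt
  check true  true  true  = tt

triangleCut-nonconstant : ∀ a b d → ¬ (a ≡ b × b ≡ d) → triangleCut a b d ≡ 2
triangleCut-nonconstant false false false split = ⊥-elim (split (refl , refl))
triangleCut-nonconstant false false true  _     = refl
triangleCut-nonconstant false true  false _     = refl
triangleCut-nonconstant false true  true  _     = refl
triangleCut-nonconstant true  false false _     = refl
triangleCut-nonconstant true  false true  _     = refl
triangleCut-nonconstant true  true  false _     = refl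
triangleCut-nonconstant true  true  true  split = ⊥-elim (split (refl , refl))

n*[2+x]+n*[2+y]+n*[2+z] : ∀ n x y z → n * (2 + x) + (n * (2 + y) + n * (2 + z)) ≡ n * (6 + (x + y + z))
n*[2+x]+n*[2+y]+n*[2+z] = solve-∀

n*8+n≡3*[n*3] : ∀ n → n * 8 + n ≡ 3 * (n * 3)
n*8+n≡3*[n*3] = solve-∀

n*6+2*n≡n*8 : ∀ n → n * 6 + 2 * n ≡ n * 8
n*6+2*n≡n*8 = solve-∀

module _ (c : ℕ) (p : Partition (Tgraph c)) where

  private
    gadget : Fin (TN c) → Fin (TN c) → Fin 3 → ℕ
    gadget a b g = crossingCount p (gadgetEdges c a b (tint g))

  cutSize-Tgraph : cutSize (Tgraph c) p ≡
    gadget (tu c) (tv c) fzero + (gadget (tu c) (tw c) (fsuc fzero) + gadget (tv c) (tw c) (fsuc (fsuc fzero)))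
  cutSize-Tgraph = trans (crossingCount-++ p (gadgetEdges c (tu c) (tv c) (tint fzero)) _)
    (cong (gadget (tu c) (tv c) fzero +_)
          (crossingCount-++ p (gadgetEdges c (tu c) (tw c) (tint (fsuc fzero))) _))

  cutSize-Tgraph-≤ : cutSize (Tgraph c) p ≤ c * (6 + triangleCut (p (tu c)) (p (tv c)) (p (tw c)))
  cutSize-Tgraph-≤ = begin
    cutSize (Tgraph c) p ≡⟨ cutSize-Tgraph ⟩
    gadget (tu c) (tv c) fzero + (gadget (tu c) (tw c) (fsuc fzero) + gadget (tv c) (tw c) (fsuc (fsuc fzero)))
      ≤⟨ +-mono-≤ (gadgetCut-≤ c _ _ (tint fzero) p)
         (+-mono-≤ (gadgetCut-≤ c _ _ (tint (fsuc fzero)) p)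
                   (gadgetCut-≤ c _ _ (tint (fsuc (fsuc fzero))) p)) ⟩
    c * (2 + differ (p (tu c)) (p (tv c)))
      + (c * (2 + differ (p (tu c)) (p (tw c))) + c * (2 + differ (p (tv c)) (p (tw c))))
      ≡⟨ n*[2+x]+n*[2+y]+n*[2+z] c _ _ _ ⟩
    c * (6 + triangleCut (p (tu c)) (p (tv c)) (p (tw c))) ∎
    where open ≤-Reasoning

gadgetSource : Bool → Bool → Fin 3 → Bool
gadgetSource su sv fzero               = su
gadgetSource su sv (fsuc fzero)        = su
gadgetSource su sv (fsuc (fsuc fzero)) = sv

triangleExtension : ∀ c → Bool → Bool → Bool → Partition (Tgraph c)
triangleExtension c su sv sw fzero                  = su
triangleExtension c su sv sw (fsuc fzero)           = sv
triangleExtension c su sv sw (fsuc (fsuc fzero))    = sw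
triangleExtension c su sv sw (fsuc (fsuc (fsuc k))) =
  let (g , ij) = remQuot {3} (c * 2) k in alternate (gadgetSource su sv g) (proj₂ (remQuot {c} 2 ij))

module _ (c : ℕ) (su sv sw : Bool) where

  private
    p : Partition (Tgraph c)
    p = triangleExtension c su sv sw

  triangleExtension-internal : ∀ g i j → p (tint g i j) ≡ alternate (gadgetSource su sv g) j
  triangleExtension-internal g i j = begin
    p (tint g i j)
      ≡⟨ cong (λ (g′ , ij) → alternate (gadgetSource su sv g′) (proj₂ (remQuot {c} 2 ij)))
              (remQuot-combine {3} {c * 2} g (combine i j)) ⟩
    alternate (gadgetSource su sv g) (proj₂ (remQuot {c} 2 (combine i j)))
      ≡⟨ cong (alternate (gadgetSource su sv g) ∘ proj₂) (remQuot-combine {c} {2} i j) ⟩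
    alternate (gadgetSource su sv g) j ∎
    where open ≡-Reasoning

  triangleExtension-cutSize : cutSize (Tgraph c) p ≡ c * (6 + triangleCut su sv sw)
  triangleExtension-cutSize = begin
    cutSize (Tgraph c) p ≡⟨ cutSize-Tgraph c p ⟩
    _ ≡⟨ cong₂ _+_ (alternating (tu c) (tv c) fzero (triangleExtension-internal fzero))
         (cong₂ _+_ (alternating (tu c) (tw c) (fsuc fzero) (triangleExtension-internal (fsuc fzero)))
                    (alternating (tv c) (tw c) (fsuc (fsuc fzero))
                                 (triangleExtension-internal (fsuc (fsuc fzero))))) ⟩
    _ ≡⟨ n*[2+x]+n*[2+y]+n*[2+z] c _ _ _ ⟩
    c * (6 + triangleCut su sv sw) ∎
    where
    open ≡-Reasoning
    alternating : ∀ a b g → (∀ i j → p (tint g i j) ≡ alternate (p a) j) →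
      crossingCount p (gadgetEdges c a b (tint g)) ≡ c * (2 + differ (p a) (p b))
    alternating a b g internal =
      gadgetCut-alternating c a b (tint g) p (λ i → internal i fzero) (λ i → internal i (fsuc fzero))

cutSize-Tgraph≤c*8 : ∀ c p → cutSize (Tgraph c) p ≤ c * 8
cutSize-Tgraph≤c*8 c p = ≤-trans (cutSize-Tgraph-≤ c p)
  (*-monoʳ-≤ c (+-monoʳ-≤ 6 (triangleCut-≤ (p (tu c)) (p (tv c)) (p (tw c)))))

mcut-Tgraph : ∀ c → mcut (Tgraph c) ≡ c * 8
mcut-Tgraph c = mcut-attained (Tgraph c) (cutSize-Tgraph≤c*8 c)
  (triangleExtension c true false false) (triangleExtension-cutSize c true false false)

module _ (c : ℕ) where

  mcut-Tgraph+c≡3*mcut-F' : mcut (Tgraph c) + c ≡ 3 * mcut (F' c)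
  mcut-Tgraph+c≡3*mcut-F' = begin
    mcut (Tgraph c) + c ≡⟨ cong (_+ c) (mcut-Tgraph c) ⟩
    c * 8 + c           ≡⟨ n*8+n≡3*[n*3] c ⟩
    3 * (c * 3)         ≡⟨ cong (3 *_) (mcut-F' c) ⟨
    3 * mcut (F' c)     ∎
    where open ≡-Reasoning

  cutSize-Tgraph-monochromatic : (p : Partition (Tgraph c)) →
    p (tu c) ≡ true → p (tv c) ≡ true → p (tw c) ≡ true →
    cutSize (Tgraph c) p + 2 * c ≤ mcut (Tgraph c)
  cutSize-Tgraph-monochromatic p pu pv pw = begin
    cutSize (Tgraph c) p + 2 * c       ≤⟨ +-monoˡ-≤ (2 * c) (cutSize-Tgraph-≤ c p) ⟩
    c * (6 + triangleCut (p (tu c)) (p (tv c)) (p (tw c))) + 2 * c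
      ≡⟨ cong (λ t → c * (6 + t) + 2 * c) (cong₂ (λ a b → triangleCut a b (p (tw c))) pu pv) ⟩
    c * (6 + triangleCut true true (p (tw c))) + 2 * c
      ≡⟨ cong (λ w → c * (6 + triangleCut true true w) + 2 * c) pw ⟩
    c * 6 + 2 * c                      ≡⟨ n*6+2*n≡n*8 c ⟩
    c * 8                              ≡⟨ mcut-Tgraph c ⟨
    mcut (Tgraph c)                    ∎
    where open ≤-Reasoning

  nonconstant-extends-to-optimal : (su sv sw : Bool) → ¬ (su ≡ sv × sv ≡ sw) →
    Σ (Partition (Tgraph c)) (λ p → (p (tu c) ≡ su × p (tv c) ≡ sv × p (tw c) ≡ sw)
                                   × cutSize (Tgraph c) p ≡ mcut (Tgraph c))
  nonconstant-extends-to-optimal su sv sw nonconstant =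
    triangleExtension c su sv sw , (refl , refl , refl) , optimal
    where
    open ≡-Reasoning
    optimal : cutSize (Tgraph c) (triangleExtension c su sv sw) ≡ mcut (Tgraph c)
    optimal = begin
      cutSize (Tgraph c) (triangleExtension c su sv sw)
        ≡⟨ triangleExtension-cutSize c su sv sw ⟩
      c * (6 + triangleCut su sv sw)
        ≡⟨ cong (λ t → c * (6 + t)) (triangleCut-nonconstant su sv sw nonconstant) ⟩
      c * 8
        ≡⟨ mcut-Tgraph c ⟨
      mcut (Tgraph c) ∎

mainTheorem4 : (n D : ℕ) → n ≥ 1 → D ≥ 1 →
    (mcut (Tgraph (Cconst n D)) + Cconst n D ≡ 3 * mcut (F' (Cconst n D)))
    × ((p : Partition (Tgraph (Cconst n D))) →
        p (tu (Cconst n D)) ≡ true → p (tv (Cconst n D)) ≡ true → p (tw (Cconst n D)) ≡ true →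
        cutSize (Tgraph (Cconst n D)) p + 2 * Cconst n D ≤ mcut (Tgraph (Cconst n D)))
    × ((su sv sw : Bool) → ¬ (su ≡ sv × sv ≡ sw) →
        Σ (Partition (Tgraph (Cconst n D))) (λ p →
          (p (tu (Cconst n D)) ≡ su × p (tv (Cconst n D)) ≡ sv × p (tw (Cconst n D)) ≡ sw)
          × cutSize (Tgraph (Cconst n D)) p ≡ mcut (Tgraph (Cconst n D))))
-- The three claims hold for any number c of paths per gadget; the value of C and the
-- hypotheses n ≥ 1, D ≥ 1 play no role.
mainTheorem4 n D _ _ =
  mcut-Tgraph+c≡3*mcut-F' C , cutSize-Tgraph-monochromatic C , nonconstant-extends-to-optimal C
  where C = Cconst n D
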